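{- Let $\mathcal{G}=(V_\mathcal{G},E^+_\mathcal{G},E^-_\mathcal{G},L_\mathcal{G})$ be a signed graph with $V_\mathcal{G}=[n]$. If $\bar{\omega}$ is a full cyclic permutation ordering of $\bar{\mathcal{G}}$ and $|L_\mathcal{G}|$ is even (respectively, odd), then every edge ordering $\omega$ of $\mathcal{G}$ with $\varphi(\omega)=\bar{\omega}$ is an even (respectively, odd) full cyclic permutation ordering of $\mathcal{G}$.
   Context: $[n]=\{1,\dots,n\}$, $I_n=\{ -n,\dots,-1,1,\dots,n\}$, $\mathfrak{H}_n=\{\eta\in\mathfrak{S}_{I_n}:\eta(-i)=-\eta(i)\ \forall i\in I_n\}$. For distinct $i,j\in[n]$: $(i\ j)$ swaps $i\leftrightarrow j$, $-i\leftrightarrow -j$; $(i\ { -j})$ sends $i\mapsto -j$, $j\mapsto -i$ (and correspondingly on negatives); for $i\in[n]$, $(i\ { -i})$ swaps $i\leftrightarrow -i$; each fixes everything else. $\eta\in\mathfrak{H}_n$ is an even (resp. odd) full cyclic permutation if there are an ordering $i_1,\dots,i_n$ of $[n]$ and signs $\epsilon_k\in\{\pm1\}$ with $\eta(i_k)=\epsilon_k i_{k+1}$ (indices mod $n$) and $\epsilon_1\cdots\epsilon_n=+1$ (resp. $-1$). A signed graph is $\mathcal{G}=(V_\mathcal{G},E^+_\mathcal{G},E^-_\mathcal{G},L_\mathcal{G})$ with $V_\mathcal{G}=[n]$, $E^\pm_\mathcal{G}$ sets of 2-element subsets of $[n]$, $L_\mathcal{G}\subseteq[n]$ (loops); $E_\mathcal{G}=E^+_\mathcal{G}\sqcup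 E^-_\mathcal{G}\sqcup L_\mathcal{G}$. Set $\tau_e=(i\ j)$, $(i\ { -j})$, $(i\ { -i})$ for $e=\{i,j\}\in E^+_\mathcal{G}$, $e=\{i,j\}\in E^-_\mathcal{G}$, $e=i\in L_\mathcal{G}$ respectively. For an edge ordering (linear order) $\omega=(e_1,\dots,e_m)$ of $E_\mathcal{G}$, $\pi_\omega=\tau_{e_m}\cdots\tau_{e_1}$; $\omega$ is an even (resp. odd) full cyclic permutation ordering if $\pi_\omega$ is an even (resp. odd) full cyclic permutation. $\bar{\mathcal{G}}$ is the unsigned multigraph on $[n]$ with edges $E^+_\mathcal{G}\sqcup E^-_\mathcal{G}$, and $\varphi(\omega)$ is the edge ordering of $\bar{\mathcal{G}}$ obtained from $\omega$ by deleting loops. An edge ordering $(f_1,\dots,f_k)$ of $\bar{\mathcal{G}}$ with $f_t=\{a_t,b_t\}$ is a full cyclic permutation ordering if $(a_k\ b_k)\cdots(a_1\ b_1)\in\mathfrak{S}_n$ is a cycle of length $n$. -}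

module Defs where

open import Data.Nat using (ℕ; zero; suc)
open import Data.Nat.Properties using (_≟_)
open import Data.Fin using (Fin; toℕ; lower₁; _<_) renaming (zero to fzero; suc to fsuc)
import Data.Fin as F
open import Data.Fin.Permutation using (Permutation′; _⟨$⟩ʳ_)
open import Data.Sign using (Sign; +; -; opposite; _*_)
open import Data.Product using (_×_; _,_; proj₁; proj₂; ∃)
open import Data.List using (List; []; _∷_; _++_; map; length)
open import Data.List.Relation.Unary.All using (All)
open import Data.List.Relation.Unary.Unique.Propositional using (Unique)
open import Data.List.Relation.Binary.Permutation.Propositional using (_↭_)
open import Relation.Nullary using (yes; no)
open import Relation.Binary.PropositionalEquality using (_≡_)
open import Function using (id; _∘_)

next : ∀ {n} → Fin n → Fin n
next {suc m} i with m ≟ toℕ i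
... | yes _ = fzero
... | no ne = fsuc (lower₁ i ne)

-- I_n : the signed element s·(i+1) is represented as (s , i).
I : ℕ → Set
I n = Sign × Fin n

signProd : ∀ {n} → (Fin n → Sign) → Sign
signProd {zero} ε = +
signProd {suc n} ε = ε fzero * signProd (ε ∘ fsuc)

IsFullCyclic : ∀ {n} → Sign → (I n → I n) → Set
IsFullCyclic {n} s η =
  ∃ λ (ι : Permutation′ n) → ∃ λ (ε : Fin n → Sign) →
    (∀ k → η (+ , ι ⟨$⟩ʳ k) ≡ (ε k , ι ⟨$⟩ʳ next k)) × signProd ε ≡ s

IsEvenFullCyclic IsOddFullCyclic : ∀ {n} → (I n → I n) → Set
IsEvenFullCyclic = IsFullCyclic +
IsOddFullCyclic  = IsFullCyclic -

IsNCycle : ∀ {n} → (Fin n → Fin n) → Set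
IsNCycle {n} σ = ∃ λ (ι : Permutation′ n) → ∀ k → σ (ι ⟨$⟩ʳ k) ≡ ι ⟨$⟩ʳ next k

-- Signed graphs on [n]; a 2-element subset {i,j} is stored as (i , j) with i < j.
record SignedGraph (n : ℕ) : Set where
  field
    E⁺ : List (Fin n × Fin n)
    E⁻ : List (Fin n × Fin n)
    L  : List (Fin n)
    E⁺-pairs : All (λ e → proj₁ e < proj₂ e) E⁺
    E⁻-pairs : All (λ e → proj₁ e < proj₂ e) E⁻
    E⁺-set : Unique E⁺
    E⁻-set : Unique E⁻
    L-set  : Unique L
open SignedGraph public

data Edge (n : ℕ) : Set where
  pos  : Fin n → Fin n → Edge n
  neg  : Fin n → Fin n → Edge n
  loop : Fin n → Edge n

edges : ∀ {n} → SignedGraph n → List (Edge n)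
edges G = map (λ e → pos (proj₁ e) (proj₂ e)) (E⁺ G)
       ++ map (λ e → neg (proj₁ e) (proj₂ e)) (E⁻ G)
       ++ map loop (L G)

IsEdgeOrdering : ∀ {n} → SignedGraph n → List (Edge n) → Set
IsEdgeOrdering G ω = ω ↭ edges G

τ : ∀ {n} → Edge n → I n → I n
τ (pos i j) (s , k) with k F.≟ i | k F.≟ j
... | yes _ | _     = (s , j)
... | no _  | yes _ = (s , i)
... | no _  | no _  = (s , k)
τ (neg i j) (s , k) with k F.≟ i | k F.≟ j
... | yes _ | _     = (opposite s , j)
... | no _  | yes _ = (opposite s , i)
... | no _  | no _  = (s , k)
τ (loop i) (s , k) with k F.≟ i
... | yes _ = (opposite s , k)
... | no _  = (s , k)

πω : ∀ {n} → List (Edge n) → I n → I n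
πω [] = id
πω (e ∷ es) = πω es ∘ τ e

IsEvenFCPOrdering IsOddFCPOrdering : ∀ {n} → SignedGraph n → List (Edge n) → Set
IsEvenFCPOrdering G ω = IsEdgeOrdering G ω × IsEvenFullCyclic (πω ω)
IsOddFCPOrdering  G ω = IsEdgeOrdering G ω × IsOddFullCyclic (πω ω)

barEdges : ∀ {n} → SignedGraph n → List (Fin n × Fin n)
barEdges G = E⁺ G ++ E⁻ G

φ : ∀ {n} → List (Edge n) → List (Fin n × Fin n)
φ [] = []
φ (pos i j ∷ ω) = (i , j) ∷ φ ω
φ (neg i j ∷ ω) = (i , j) ∷ φ ω
φ (loop i ∷ ω) = φ ω

swap : ∀ {n} → Fin n → Fin n → Fin n → Fin n
swap a b k with k F.≟ a | k F.≟ b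
... | yes _ | _     = b
... | no _  | yes _ = a
... | no _  | no _  = k

uprod : ∀ {n} → List (Fin n × Fin n) → Fin n → Fin n
uprod [] = id
uprod ((a , b) ∷ fs) = uprod fs ∘ swap a b

IsBarFCPOrdering : ∀ {n} → SignedGraph n → List (Fin n × Fin n) → Set
IsBarFCPOrdering G ω̄ = (ω̄ ↭ barEdges G) × IsNCycle (uprod ω̄)

-- Every signed permutation has the form (g ⋉ σ)(s , k) = (s g(k) , σ k) with σ ∈ 𝔖_n and
-- a sign vector g, and the total sign ∏ g is multiplicative under composition, since
-- reindexing a product by a permutation does not change it. For τ_e, σ is the
-- transposition of the corresponding edge of Ḡ (the identity for a loop) and ∏ g is +
-- for a positive edge, (-)(-) = + for a negative edge and - for a loop. So π_ω lies over
-- the n-cycle given by φ(ω) with total sign (-1)^|L|, and the signs ε are those of π_ω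
-- read along the cycle.
module Submission where

open import Defs
open import Data.Nat using (ℕ; _%_)
open import Data.Fin using (Fin)
open import Data.Product using (_×_)
open import Data.List using (List; length)
open import Relation.Binary.PropositionalEquality using (_≡_)

open import Algebra.Bundles using (Monoid)
open import Data.Nat using (zero; suc)
open import Data.Fin using (punchIn) renaming (zero to fzero)
import Data.Fin as F
open import Data.Fin.Properties using (punchInᵢ≢i; <⇒≢)
open import Data.Fin.Permutation using (Permutation′; _⟨$⟩ʳ_; transpose)
open import Data.Sign using (Sign; +; -; opposite; _*_)
open import Data.Sign.Properties
  using (opposite-involutive; *-identityʳ; *-assoc; *-monoid; *-commutativeMonoid)
open import Algebra.Properties.CommutativeMonoid.Sum *-commutativeMonoid
  using (sum; sum-remove; sum-permute; ∑-distrib-+; sum-replicate-zero)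
-- m · s is the m-fold product s * ⋯ * s, so m · - is (-1)^m.
open import Algebra.Definitions.RawMonoid (Monoid.rawMonoid *-monoid)
  using () renaming (_×_ to _·_)
open import Data.Product using (_,_; proj₁; proj₂)
open import Data.Maybe using (Maybe; just; nothing)
open import Data.List using ([]; _∷_; _++_; map; mapMaybe)
open import Data.List.Properties using (mapMaybe-++; mapMaybe-map-none; mapMaybe-map-retract)
open import Data.List.Relation.Unary.All using (All; []; _∷_; universal)
open import Data.List.Relation.Unary.All.Properties using (++⁺; map⁺)
open import Data.List.Relation.Binary.Permutation.Propositional using (↭-sym)
open import Data.List.Relation.Binary.Permutation.Propositional.Properties
  using (All-resp-↭; mapMaybe-↭; ↭-length)
open import Data.Unit using (⊤; tt)
open import Relation.Nullary using (yes; no; ¬_; contradiction)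
open import Relation.Binary.PropositionalEquality
  using (_≗_; refl; sym; trans; cong; cong₂; subst; module ≡-Reasoning)
open import Function using (_∘_; id)

signProd≡sum : ∀ {n} (f : Fin n → Sign) → signProd f ≡ sum f
signProd≡sum {zero}  f = refl
signProd≡sum {suc n} f = cong (f fzero *_) (signProd≡sum (f ∘ F.suc))

signProd-cong : ∀ {n} {f g : Fin n → Sign} → f ≗ g → signProd f ≡ signProd g
signProd-cong {zero}  f≗g = refl
signProd-cong {suc n} f≗g = cong₂ _*_ (f≗g fzero) (signProd-cong (f≗g ∘ F.suc))

signProd-const+ : ∀ n → signProd {n} (λ _ → +) ≡ +
signProd-const+ n = trans (signProd≡sum {n} (λ _ → +)) (sum-replicate-zero n)

signProd-* : ∀ {n} (f g : Fin n → Sign) → signProd (λ k → f k * g k) ≡ signProd f * signProd g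
signProd-* f g = begin
  signProd (λ k → f k * g k) ≡⟨ signProd≡sum (λ k → f k * g k) ⟩
  sum (λ k → f k * g k)      ≡⟨ ∑-distrib-+ f g ⟩
  sum f * sum g              ≡⟨ sym (cong₂ _*_ (signProd≡sum f) (signProd≡sum g)) ⟩
  signProd f * signProd g    ∎
  where open ≡-Reasoning

signProd-permute : ∀ {n} (π : Permutation′ n) (f : Fin n → Sign) →
                   signProd (f ∘ (π ⟨$⟩ʳ_)) ≡ signProd f
signProd-permute π f = begin
  signProd (f ∘ (π ⟨$⟩ʳ_)) ≡⟨ signProd≡sum (f ∘ (π ⟨$⟩ʳ_)) ⟩
  sum (f ∘ (π ⟨$⟩ʳ_))      ≡⟨ sym (sum-permute f π) ⟩
  sum f                    ≡⟨ sym (signProd≡sum f) ⟩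
  signProd f               ∎
  where open ≡-Reasoning

indicator : ∀ {n} → Fin n → Fin n → Sign
indicator i k with k F.≟ i
... | yes _ = -
... | no _  = +

signProd-indicator : ∀ {n} (i : Fin n) → signProd (indicator i) ≡ -
signProd-indicator {suc n} i = begin
  signProd (indicator i)                          ≡⟨ signProd≡sum (indicator i) ⟩
  sum (indicator i)                               ≡⟨ sum-remove {i = i} (indicator i) ⟩
  indicator i i * sum (indicator i ∘ punchIn i)   ≡⟨ cong₂ _*_ at-i elsewhere ⟩
  -                                               ∎
  where
  open ≡-Reasoning
  at-i : indicator i i ≡ -
  at-i with i F.≟ i
  ... | yes _  = refl
  ... | no i≢i = contradiction refl i≢i
  off-i : ∀ k → indicator i (punchIn i k) ≡ +
  off-i k with punchIn i k F.≟ i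
  ... | yes eq = contradiction eq (punchInᵢ≢i i k)
  ... | no _   = refl
  elsewhere : sum (indicator i ∘ punchIn i) ≡ +
  elsewhere = begin
    sum (indicator i ∘ punchIn i)       ≡⟨ sym (signProd≡sum (indicator i ∘ punchIn i)) ⟩
    signProd (indicator i ∘ punchIn i)  ≡⟨ signProd-cong off-i ⟩
    signProd {n} (λ _ → +)              ≡⟨ signProd-const+ n ⟩
    +                                   ∎

_⋉_ : ∀ {n} → (Fin n → Sign) → (Fin n → Fin n) → I n → I n
(g ⋉ σ) (s , k) = s * g k , σ k

⋉-∘ : ∀ {n} (g g′ : Fin n → Sign) (σ σ′ : Fin n → Fin n) →
      (g′ ⋉ σ′) ∘ (g ⋉ σ) ≗ (λ k → g k * g′ (σ k)) ⋉ (σ′ ∘ σ)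
⋉-∘ g g′ σ σ′ (s , k) = cong (_, σ′ (σ k)) (*-assoc s (g k) (g′ (σ k)))

fullCyclic-⋉ : ∀ {n} {η : I n → I n} (g : Fin n → Sign) {σ : Fin n → Fin n} →
               η ≗ g ⋉ σ → IsNCycle σ → IsFullCyclic (signProd g) η
fullCyclic-⋉ {η = η} g η≗ (ι , cycle) =
  ι , g ∘ (ι ⟨$⟩ʳ_) , step , signProd-permute ι g
  where
  step : ∀ k → η (+ , ι ⟨$⟩ʳ k) ≡ (g (ι ⟨$⟩ʳ k) , ι ⟨$⟩ʳ next k)
  step k = trans (η≗ (+ , ι ⟨$⟩ʳ k)) (cong (g (ι ⟨$⟩ʳ k) ,_) (cycle k))

edgeSign : ∀ {n} → Edge n → Fin n → Sign
edgeSign (pos i j) k = +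
edgeSign (neg i j) k with k F.≟ i | k F.≟ j
... | yes _ | _     = -
... | no _  | yes _ = -
... | no _  | no _  = +
edgeSign (loop i) k = indicator i k

edgePerm : ∀ {n} → Edge n → Fin n → Fin n
edgePerm (pos i j) = Defs.swap i j
edgePerm (neg i j) = Defs.swap i j
edgePerm (loop i)  = id

s*-≡opposite : ∀ s → s * - ≡ opposite s
s*-≡opposite + = refl
s*-≡opposite - = refl

τ≗⋉ : ∀ {n} (e : Edge n) → τ e ≗ edgeSign e ⋉ edgePerm e
τ≗⋉ (pos i j) (s , k) with k F.≟ i | k F.≟ j
... | yes _ | _     = cong (_, j) (sym (*-identityʳ s))
... | no _  | yes _ = cong (_, i) (sym (*-identityʳ s))
... | no _  | no _  = cong (_, k) (sym (*-identityʳ s))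
τ≗⋉ (neg i j) (s , k) with k F.≟ i | k F.≟ j
... | yes _ | _     = cong (_, j) (sym (s*-≡opposite s))
... | no _  | yes _ = cong (_, i) (sym (s*-≡opposite s))
... | no _  | no _  = cong (_, k) (sym (*-identityʳ s))
τ≗⋉ (loop i) (s , k) with k F.≟ i
... | yes _ = cong (_, k) (sym (s*-≡opposite s))
... | no _  = cong (_, k) (sym (*-identityʳ s))

swap≗transpose : ∀ {n} (i j : Fin n) → Defs.swap i j ≗ transpose i j ⟨$⟩ʳ_
swap≗transpose i j k with k F.≟ i
... | yes _ = refl
... | no _ with k F.≟ j
...   | yes _ = refl
...   | no _  = refl

signProd-∘-edgePerm : ∀ {n} (e : Edge n) (f : Fin n → Sign) →
                      signProd (f ∘ edgePerm e) ≡ signProd f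
signProd-∘-edgePerm (pos i j) f =
  trans (signProd-cong (cong f ∘ swap≗transpose i j)) (signProd-permute (transpose i j) f)
signProd-∘-edgePerm (neg i j) f =
  trans (signProd-cong (cong f ∘ swap≗transpose i j)) (signProd-permute (transpose i j) f)
signProd-∘-edgePerm (loop i) f = refl

-- A negative edge {i , i} would have total sign -, so distinctness is used here.
Proper : ∀ {n} → Edge n → Set
Proper (neg i j) = ¬ i ≡ j
Proper _         = ⊤

edges-proper : ∀ {n} (G : SignedGraph n) → All Proper (edges G)
edges-proper G = ++⁺ (map⁺ (universal (λ _ → tt) (E⁺ G)))
                     (++⁺ (map⁺ (negProper (E⁻-pairs G))) (map⁺ (universal (λ _ → tt) (L G))))
  where
  negProper : ∀ {xs} → All (λ e → proj₁ e F.< proj₂ e) xs →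
              All (λ e → ¬ proj₁ e ≡ proj₂ e) xs
  negProper []       = []
  negProper (p ∷ ps) = <⇒≢ p ∷ negProper ps

loopVertex : ∀ {n} → Edge n → Maybe (Fin n)
loopVertex (loop i) = just i
loopVertex _        = nothing

loops : ∀ {n} → List (Edge n) → List (Fin n)
loops = mapMaybe loopVertex

loops-edges : ∀ {n} (G : SignedGraph n) → loops (edges G) ≡ L G
loops-edges G = begin
  loops (posEdges ++ negEdges ++ loopEdges)
    ≡⟨ mapMaybe-++ loopVertex posEdges _ ⟩
  loops posEdges ++ loops (negEdges ++ loopEdges)
    ≡⟨ cong (_++ loops (negEdges ++ loopEdges)) (mapMaybe-map-none (λ _ → refl) (E⁺ G)) ⟩
  loops (negEdges ++ loopEdges)
    ≡⟨ mapMaybe-++ loopVertex negEdges _ ⟩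
  loops negEdges ++ loops loopEdges
    ≡⟨ cong (_++ loops loopEdges) (mapMaybe-map-none (λ _ → refl) (E⁻ G)) ⟩
  loops loopEdges
    ≡⟨ mapMaybe-map-retract (λ _ → refl) (L G) ⟩
  L G ∎
  where
  open ≡-Reasoning
  posEdges = map (λ e → pos (proj₁ e) (proj₂ e)) (E⁺ G)
  negEdges = map (λ e → neg (proj₁ e) (proj₂ e)) (E⁻ G)
  loopEdges = map loop (L G)

loopSign : ∀ {n} → Edge n → Sign
loopSign (loop i) = -
loopSign _        = +

loopSign-* : ∀ {n} (e : Edge n) ω →
             loopSign e * length (loops ω) · - ≡ length (loops (e ∷ ω)) · -
loopSign-* (pos i j) ω = refl
loopSign-* (neg i j) ω = refl
loopSign-* (loop i)  ω = refl

signProd-edgeSign : ∀ {n} (e : Edge n) → Proper e → signProd (edgeSign e) ≡ loopSign e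
signProd-edgeSign {n} (pos i j) _ = signProd-const+ n
signProd-edgeSign (neg i j) i≢j = begin
  signProd (edgeSign (neg i j))
    ≡⟨ signProd-cong product ⟩
  signProd (λ k → indicator i k * indicator j k)
    ≡⟨ signProd-* (indicator i) (indicator j) ⟩
  signProd (indicator i) * signProd (indicator j)
    ≡⟨ cong₂ _*_ (signProd-indicator i) (signProd-indicator j) ⟩
  + ∎
  where
  open ≡-Reasoning
  product : ∀ k → edgeSign (neg i j) k ≡ indicator i k * indicator j k
  product k with k F.≟ i | k F.≟ j
  ... | yes k≡i | yes k≡j = contradiction (trans (sym k≡i) k≡j) i≢j
  ... | yes _   | no _    = refl
  ... | no _    | yes _   = refl
  ... | no _    | no _    = refl
signProd-edgeSign (loop i) _ = signProd-indicator i

signVector : ∀ {n} → List (Edge n) → Fin n → Sign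
signVector []      k = +
signVector (e ∷ ω) k = edgeSign e k * signVector ω (edgePerm e k)

uprod-φ-∷ : ∀ {n} (e : Edge n) ω → uprod (φ (e ∷ ω)) ≗ uprod (φ ω) ∘ edgePerm e
uprod-φ-∷ (pos i j) ω k = refl
uprod-φ-∷ (neg i j) ω k = refl
uprod-φ-∷ (loop i)  ω k = refl

πω≗⋉ : ∀ {n} (ω : List (Edge n)) → πω ω ≗ signVector ω ⋉ uprod (φ ω)
πω≗⋉ []      (s , k) = cong (_, k) (sym (*-identityʳ s))
πω≗⋉ (e ∷ ω) (s , k) = begin
  πω ω (τ e (s , k))
    ≡⟨ cong (πω ω) (τ≗⋉ e (s , k)) ⟩
  πω ω ((edgeSign e ⋉ edgePerm e) (s , k))
    ≡⟨ πω≗⋉ ω _ ⟩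
  (signVector ω ⋉ uprod (φ ω)) ((edgeSign e ⋉ edgePerm e) (s , k))
    ≡⟨ ⋉-∘ (edgeSign e) (signVector ω) (edgePerm e) (uprod (φ ω)) (s , k) ⟩
  s * signVector (e ∷ ω) k , uprod (φ ω) (edgePerm e k)
    ≡⟨ cong (s * signVector (e ∷ ω) k ,_) (sym (uprod-φ-∷ e ω k)) ⟩
  (signVector (e ∷ ω) ⋉ uprod (φ (e ∷ ω))) (s , k) ∎
  where open ≡-Reasoning

signProd-signVector : ∀ {n} (ω : List (Edge n)) → All Proper ω →
                      signProd (signVector ω) ≡ length (loops ω) · -
signProd-signVector {n} [] [] = signProd-const+ n
signProd-signVector (e ∷ ω) (proper ∷ propers) = begin
  signProd (signVector (e ∷ ω))
    ≡⟨ signProd-* (edgeSign e) (signVector ω ∘ edgePerm e) ⟩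
  signProd (edgeSign e) * signProd (signVector ω ∘ edgePerm e)
    ≡⟨ cong₂ _*_ (signProd-edgeSign e proper) (signProd-∘-edgePerm e (signVector ω)) ⟩
  loopSign e * signProd (signVector ω)
    ≡⟨ cong (loopSign e *_) (signProd-signVector ω propers) ⟩
  loopSign e * length (loops ω) · -
    ≡⟨ loopSign-* e ω ⟩
  length (loops (e ∷ ω)) · - ∎
  where open ≡-Reasoning

πω-fullCyclic : ∀ {n} (ω : List (Edge n)) → All Proper ω → IsNCycle (uprod (φ ω)) →
                IsFullCyclic (length (loops ω) · -) (πω ω)
πω-fullCyclic ω propers cycle =
  subst (λ s → IsFullCyclic s (πω ω)) (signProd-signVector ω propers)
        (fullCyclic-⋉ (signVector ω) (πω≗⋉ ω) cycle)

·-even : ∀ m → m % 2 ≡ 0 → m · - ≡ +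
·-even zero          _  = refl
·-even (suc zero)    ()
·-even (suc (suc m)) m%2≡0 = trans (opposite-involutive (m · -)) (·-even m m%2≡0)

·-odd : ∀ m → m % 2 ≡ 1 → m · - ≡ -
·-odd zero          ()
·-odd (suc zero)    _  = refl
·-odd (suc (suc m)) m%2≡1 = trans (opposite-involutive (m · -)) (·-odd m m%2≡1)

orderings-fullCyclic : ∀ {n} (G : SignedGraph n) (ω̄ : List (Fin n × Fin n)) →
                       IsBarFCPOrdering G ω̄ → ∀ ω → IsEdgeOrdering G ω → φ ω ≡ ω̄ →
                       IsFullCyclic (length (L G) · -) (πω ω)
orderings-fullCyclic G ω̄ (_ , cycle) ω ordering refl =
  subst (λ m → IsFullCyclic (m · -) (πω ω)) sameLoopCount
        (πω-fullCyclic ω (All-resp-↭ (↭-sym ordering) (edges-proper G)) cycle)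
  where
  sameLoopCount : length (loops ω) ≡ length (L G)
  sameLoopCount = trans (↭-length (mapMaybe-↭ loopVertex ordering)) (cong length (loops-edges G))

proposition2p6 : ∀ {n : ℕ} (G : SignedGraph n) (ω̄ : List (Fin n × Fin n))
    → IsBarFCPOrdering G ω̄
    → ((length (L G) % 2 ≡ 0) → ∀ (ω : List (Edge n)) → IsEdgeOrdering G ω → φ ω ≡ ω̄ → IsEvenFCPOrdering G ω)
    × ((length (L G) % 2 ≡ 1) → ∀ (ω : List (Edge n)) → IsEdgeOrdering G ω → φ ω ≡ ω̄ → IsOddFCPOrdering G ω)
proposition2p6 G ω̄ barFCP =
  (λ even ω ordering φω≡ω̄ → ordering , withSign (·-even |L| even) ω ordering φω≡ω̄) ,
  (λ odd  ω ordering φω≡ω̄ → ordering , withSign (·-odd |L| odd) ω ordering φω≡ω̄)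
  where
  |L| : ℕ
  |L| = length (L G)
  withSign : ∀ {s} → |L| · - ≡ s →
             ∀ ω → IsEdgeOrdering G ω → φ ω ≡ ω̄ → IsFullCyclic s (πω ω)
  withSign eq ω ordering φω≡ω̄ =
    subst (λ s → IsFullCyclic s (πω ω)) eq
          (orderings-fullCyclic G ω̄ barFCP ω ordering φω≡ω̄)
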